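{- Let $b,q$ be natural numbers and $a$ an integer with $\gcd(a,b)=1$. Then $S(a,b)=k/q$ for some integer $k$ with $\gcd(k,q)=1$ if and only if $b=\frac{q(a^2+1)}{t}$ for some natural number $t$ with $\gcd(t,q)=1$.
   Context: For $x\in\mathbb{R}$ let $((x))=x-\lfloor x\rfloor-1/2$ if $x\notin\mathbb{Z}$ and $((x))=0$ if $x\in\mathbb{Z}$. For $a\in\mathbb{Z}$, $b\in\mathbb{N}$ with $\gcd(a,b)=1$, the classical Dedekind sum is $s(a,b)=\sum_{j=1}^{b}((j/b))((aj/b))$, and the normalized Dedekind sum is $S(a,b)=12\,s(a,b)$. -}

module Defs where

open import Data.Nat as ℕ using (ℕ; zero; suc; NonZero)
open import Data.Integer as ℤ using (ℤ; +_)
open import Data.Rational using (ℚ; _+_; _-_; _*_; _/_; ↧ₙ_; floor; ½; 0ℚ)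
open import Relation.Nullary using (yes; no)

-- The sawtooth function ((x)) on rationals:
-- ((x)) = x - ⌊x⌋ - 1/2 if x is not an integer, and 0 if x is an integer.
-- A (normalised) rational is an integer iff its reduced denominator is 1.
saw : ℚ → ℚ
saw x with (↧ₙ x) ℕ.≟ 1
... | yes _ = 0ℚ
... | no  _ = x - (floor x / 1) - ½

sumFrom1 : ℕ → (ℕ → ℚ) → ℚ
sumFrom1 zero    f = 0ℚ
sumFrom1 (suc n) f = sumFrom1 n f + f (suc n)

s : ℤ → (b : ℕ) → .{{NonZero b}} → ℚ
s a b = sumFrom1 b (λ j → saw (+ j / b) * saw ((a ℤ.* + j) / b))

S : ℤ → (b : ℕ) → .{{NonZero b}} → ℚ
S a b = (+ 12 / 1) * s a b

-- Let r_j be the residue of a·j modulo b. For 0 < j < b the sawtooth values are ((j/b)) = (2j - b)/2b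
-- and ((aj/b)) = (2r_j - b)/2b, so s(a,b) = T/4b² with T = Σ_j (2j - b)(2r_j - b). Since j ↦ r_j
-- permutes {1, …, b-1}, summing one polynomial identity per j gives 3aT ≡ b(a² + 1) (mod b²).
-- Hence S(a,b) = 3T/b² = N/b with aN ≡ a² + 1 (mod b), so gcd(N, b) = gcd(a² + 1, b), and both
-- sides of the equivalence say that q is the reduced denominator b / gcd(a² + 1, b).

module Submission where

open import Defs
open import Data.Nat as ℕ using (ℕ; zero; suc; NonZero; _≤_; _<_; s≤s; z≤n)
import Data.Nat.Properties as ℕ
open import Data.Nat.Divisibility as ℕ using (_∣_; divides)
import Data.Nat.GCD as ℕ
open import Data.Nat.Coprimality as ℕ using (Coprime)
open import Data.Integer as ℤ using (ℤ; +_; -[1+_])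
import Data.Integer.Divisibility.Signed as ℤˢ
import Data.Integer.Coprimality as ℤ
import Data.Integer.Properties as ℤ
import Data.Integer.DivMod as ℤ
import Data.Integer.GCD as ℤ
open import Data.Integer.Tactic.RingSolver using (solve-∀)
open import Data.Rational as ℚ using (ℚ; mkℚ; _/_; ↥_; ↧_; ↧ₙ_; floor; 0ℚ; ½)
import Data.Rational.Properties as ℚ
import Data.Rational.Unnormalised as ℚᵘ
import Data.Rational.Unnormalised.Properties as ℚᵘ
open import Data.Empty using (⊥-elim)
open import Data.Sum using (inj₂)
open import Data.Fin as Fin using (Fin; toℕ; fromℕ<; punchOut)
import Data.Fin.Properties as Fin
open import Data.Fin.Permutation using (Permutation; permutation)
open import Data.Product using (Σ; ∃; ∃-syntax; _×_; _,_; proj₁; proj₂)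
open import Function.Bundles using (_⇔_; mk⇔; Equivalence)
import Function.Properties.Equivalence as ⇔
open import Function using (_∘_)
open import Function.Definitions using (Injective)
import Algebra.Properties.CommutativeMonoid.Sum as CommutativeMonoidSum
import Data.Vec.Functional as Vector
open import Relation.Nullary using (¬_; yes; no)
open import Relation.Binary.PropositionalEquality
open import Algebra.Properties.AbelianGroup ℤ.+-0-abelianGroup using (∙-cancelʳ)

-- Fractions i / n

fromℚᵘ-homo-+ : ∀ p q → ℚ.fromℚᵘ (p ℚᵘ.+ q) ≡ ℚ.fromℚᵘ p ℚ.+ ℚ.fromℚᵘ q
fromℚᵘ-homo-+ p q = trans
  (ℚ.fromℚᵘ-cong (ℚᵘ.≃-sym (ℚᵘ.≃-trans (ℚ.toℚᵘ-homo-+ (ℚ.fromℚᵘ p) (ℚ.fromℚᵘ q))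
                                       (ℚᵘ.+-cong (ℚ.toℚᵘ-fromℚᵘ p) (ℚ.toℚᵘ-fromℚᵘ q)))))
  (ℚ.fromℚᵘ-toℚᵘ _)

fromℚᵘ-homo-* : ∀ p q → ℚ.fromℚᵘ (p ℚᵘ.* q) ≡ ℚ.fromℚᵘ p ℚ.* ℚ.fromℚᵘ q
fromℚᵘ-homo-* p q = trans
  (ℚ.fromℚᵘ-cong (ℚᵘ.≃-sym (ℚᵘ.≃-trans (ℚ.toℚᵘ-homo-* (ℚ.fromℚᵘ p) (ℚ.fromℚᵘ q))
                                       (ℚᵘ.*-cong (ℚ.toℚᵘ-fromℚᵘ p) (ℚ.toℚᵘ-fromℚᵘ q)))))
  (ℚ.fromℚᵘ-toℚᵘ _)

fromℚᵘ-homo‿- : ∀ p → ℚ.fromℚᵘ (ℚᵘ.- p) ≡ ℚ.- ℚ.fromℚᵘ p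
fromℚᵘ-homo‿- p = trans
  (ℚ.fromℚᵘ-cong (ℚᵘ.≃-sym (ℚᵘ.≃-trans (ℚ.toℚᵘ-homo‿- (ℚ.fromℚᵘ p)) (ℚᵘ.-‿cong (ℚ.toℚᵘ-fromℚᵘ p)))))
  (ℚ.fromℚᵘ-toℚᵘ _)

*≡*⇒/≡/ : ∀ i j m n .{{_ : NonZero m}} .{{_ : NonZero n}} → i ℤ.* + n ≡ j ℤ.* + m → i / m ≡ j / n
*≡*⇒/≡/ i j (suc m) (suc n) eq = ℚ.fromℚᵘ-cong {i ℚᵘ./ suc m} {j ℚᵘ./ suc n} (ℚᵘ.*≡* eq)

/≡/⇒*≡* : ∀ i j m n .{{_ : NonZero m}} .{{_ : NonZero n}} → i / m ≡ j / n → i ℤ.* + n ≡ j ℤ.* + m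
/≡/⇒*≡* i j (suc m) (suc n) eq with ℚ.fromℚᵘ-injective {i ℚᵘ./ suc m} {j ℚᵘ./ suc n} eq
... | ℚᵘ.*≡* i*n≡j*m = i*n≡j*m

/-+-/ : ∀ i j m n .{{_ : NonZero m}} .{{_ : NonZero n}} →
        i / m ℚ.+ j / n ≡ _/_ (i ℤ.* + n ℤ.+ j ℤ.* + m) (m ℕ.* n) {{ℕ.m*n≢0 m n}}
/-+-/ i j (suc m) (suc n) = sym (fromℚᵘ-homo-+ (i ℚᵘ./ suc m) (j ℚᵘ./ suc n))

/-*-/ : ∀ i j m n .{{_ : NonZero m}} .{{_ : NonZero n}} →
        (i / m) ℚ.* (j / n) ≡ _/_ (i ℤ.* j) (m ℕ.* n) {{ℕ.m*n≢0 m n}}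
/-*-/ i j (suc m) (suc n) = sym (fromℚᵘ-homo-* (i ℚᵘ./ suc m) (j ℚᵘ./ suc n))

/+/-same : ∀ i j n .{{_ : NonZero n}} → i / n ℚ.+ j / n ≡ (i ℤ.+ j) / n
/+/-same i j n = trans (/-+-/ i j n n) (*≡*⇒/≡/ (i ℤ.* + n ℤ.+ j ℤ.* + n) (i ℤ.+ j) (n ℕ.* n) n {{ℕ.m*n≢0 n n}} cross)
  where
  factor : ∀ i j n → (i ℤ.* n ℤ.+ j ℤ.* n) ℤ.* n ≡ (i ℤ.+ j) ℤ.* (n ℤ.* n)
  factor = solve-∀
  cross : (i ℤ.* + n ℤ.+ j ℤ.* + n) ℤ.* + n ≡ (i ℤ.+ j) ℤ.* + (n ℕ.* n)
  cross = trans (factor i j (+ n)) (cong ((i ℤ.+ j) ℤ.*_) (sym (ℤ.pos-* n n)))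

-‿/ : ∀ i n .{{_ : NonZero n}} → ℚ.- (i / n) ≡ (ℤ.- i) / n
-‿/ i (suc n) = sym (fromℚᵘ-homo‿- (i ℚᵘ./ suc n))

-- Reduced denominators

↧ₙ-/ : ∀ i n .{{_ : NonZero n}} → ↧ₙ (i / n) ℕ.* ℕ.gcd ℤ.∣ i ∣ n ≡ n
↧ₙ-/ i n = ℤ.+-injective (trans (ℤ.pos-* (↧ₙ (i / n)) _) (ℚ.↧-/ i n))

↧ₙ-/≡1⇒∣ : ∀ i n .{{_ : NonZero n}} → ↧ₙ (i / n) ≡ 1 → n ∣ ℤ.∣ i ∣
↧ₙ-/≡1⇒∣ i n ↧ₙ≡1 = subst (_∣ ℤ.∣ i ∣) gcd≡n (ℕ.gcd[m,n]∣m ℤ.∣ i ∣ n)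
  where
  gcd≡n : ℕ.gcd ℤ.∣ i ∣ n ≡ n
  gcd≡n = trans (sym (ℕ.*-identityˡ _)) (trans (cong (ℕ._* ℕ.gcd ℤ.∣ i ∣ n) (sym ↧ₙ≡1)) (↧ₙ-/ i n))

∣⇒↧ₙ-/≡1 : ∀ i n .{{_ : NonZero n}} → n ∣ ℤ.∣ i ∣ → ↧ₙ (i / n) ≡ 1
∣⇒↧ₙ-/≡1 i n n∣i = ℕ.*-cancelʳ-≡ _ 1 n
  (trans (cong (↧ₙ (i / n) ℕ.*_) (sym gcd≡n)) (trans (↧ₙ-/ i n) (sym (ℕ.*-identityˡ n))))
  where
  gcd≡n : ℕ.gcd ℤ.∣ i ∣ n ≡ n
  gcd≡n = ℕ.∣-antisym (ℕ.gcd[m,n]∣n ℤ.∣ i ∣ n) (ℕ.gcd-greatest n∣i ℕ.∣-refl)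

coprime-denominator-unique : ∀ {x y x′ y′} → Coprime x y → Coprime x′ y′ → x ℕ.* y′ ≡ x′ ℕ.* y → y ≡ y′
coprime-denominator-unique {x} {y} {x′} {y′} x⊥y x′⊥y′ eq = ℕ.∣-antisym
  (ℕ.coprime-divisor (ℕ.sym x⊥y) (divides x′ eq))
  (ℕ.coprime-divisor (ℕ.sym x′⊥y′) (divides x (sym eq)))

scaled-coprime-denominator-unique : ∀ {x y x′ y′ g} .{{_ : NonZero g}} → Coprime x y → Coprime x′ y′ →
  y ℕ.* g ℕ.* x′ ≡ y′ ℕ.* (x ℕ.* g) → y ≡ y′
scaled-coprime-denominator-unique {x} {y} {x′} {y′} {g} x⊥y x′⊥y′ eq =
  coprime-denominator-unique x⊥y x′⊥y′ (ℕ.*-cancelʳ-≡ (x ℕ.* y′) (x′ ℕ.* y) g (begin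
    x ℕ.* y′ ℕ.* g       ≡⟨ cong (ℕ._* g) (ℕ.*-comm x y′) ⟩
    y′ ℕ.* x ℕ.* g       ≡⟨ ℕ.*-assoc y′ x g ⟩
    y′ ℕ.* (x ℕ.* g)     ≡⟨ eq ⟨
    y ℕ.* g ℕ.* x′       ≡⟨ ℕ.*-comm (y ℕ.* g) x′ ⟩
    x′ ℕ.* (y ℕ.* g)     ≡⟨ ℕ.*-assoc x′ y g ⟨
    x′ ℕ.* y ℕ.* g       ∎))
  where open ≡-Reasoning

coprime-↥-↧ₙ : ∀ p → Coprime ℤ.∣ ↥ p ∣ (↧ₙ p)
coprime-↥-↧ₙ (mkℚ _ _ ↥⊥↧) = ℕ.recompute ↥⊥↧

reduced-form⇔↧ₙ≡ : ∀ p q .{{_ : NonZero q}} → (∃[ k ] (Coprime ℤ.∣ k ∣ q × p ≡ k / q)) ⇔ (↧ₙ p ≡ q)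
reduced-form⇔↧ₙ≡ p q = mk⇔ to from
  where
  to : ∃[ k ] (Coprime ℤ.∣ k ∣ q × p ≡ k / q) → ↧ₙ p ≡ q
  to (k , k⊥q , refl) = trans (sym (ℕ.*-identityʳ _)) (trans (cong (↧ₙ (k / q) ℕ.*_) (sym (ℕ.coprime⇒gcd≡1 k⊥q))) (↧ₙ-/ k q))
  from : ↧ₙ p ≡ q → ∃[ k ] (Coprime ℤ.∣ k ∣ q × p ≡ k / q)
  from refl = ↥ p , coprime-↥-↧ₙ p , sym (ℚ.↥p/↧p≡p p)

↧ₙ-/-cong : ∀ i j n .{{_ : NonZero n}} → ℕ.gcd ℤ.∣ i ∣ n ≡ ℕ.gcd ℤ.∣ j ∣ n → ↧ₙ (i / n) ≡ ↧ₙ (j / n)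
↧ₙ-/-cong i j n gcd≡gcd = ℕ.*-cancelʳ-≡ _ _ (ℕ.gcd ℤ.∣ j ∣ n) {{gcd≢0}}
  (trans (cong (↧ₙ (i / n) ℕ.*_) (sym gcd≡gcd)) (trans (↧ₙ-/ i n) (sym (↧ₙ-/ j n))))
  where
  gcd≢0 : NonZero (ℕ.gcd ℤ.∣ j ∣ n)
  gcd≢0 = ℕ.≢-nonZero (ℕ.gcd[m,n]≢0 ℤ.∣ j ∣ n (inj₂ (ℕ.≢-nonZero⁻¹ n)))

gcd-cong-mod : ∀ {a N M U : ℤ} {b} → Coprime ℤ.∣ a ∣ b → a ℤ.* N ≡ U ℤ.+ + b ℤ.* M → ℕ.gcd ℤ.∣ N ∣ b ≡ ℕ.gcd ℤ.∣ U ∣ b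
gcd-cong-mod {a} {N} {M} {U} {b} a⊥b aN≡U+bM = ℕ.∣-antisym
  (ℕ.gcd-greatest (ℤˢ.∣⇒∣ᵤ d∣U) (ℕ.gcd[m,n]∣n ℤ.∣ N ∣ b))
  (ℕ.gcd-greatest e∣N (ℕ.gcd[m,n]∣n ℤ.∣ U ∣ b))
  where
  d e : ℕ
  d = ℕ.gcd ℤ.∣ N ∣ b
  e = ℕ.gcd ℤ.∣ U ∣ b
  U≡aN-bM : U ≡ a ℤ.* N ℤ.- + b ℤ.* M
  U≡aN-bM = trans (cancel U (+ b ℤ.* M)) (cong (ℤ._- + b ℤ.* M) (sym aN≡U+bM))
    where
    cancel : ∀ x y → x ≡ x ℤ.+ y ℤ.- y
    cancel = solve-∀
  d∣U : + d ℤˢ.∣ U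
  d∣U = subst (+ d ℤˢ.∣_) (sym U≡aN-bM) (ℤˢ.∣m∣n⇒∣m-n
    (ℤˢ.∣n⇒∣m*n a (ℤˢ.∣ᵤ⇒∣ {+ d} {N} (ℕ.gcd[m,n]∣m ℤ.∣ N ∣ b)))
    (ℤˢ.∣m⇒∣m*n M (ℤˢ.∣ᵤ⇒∣ {+ d} {+ b} (ℕ.gcd[m,n]∣n ℤ.∣ N ∣ b))))
  e∣aN : + e ℤˢ.∣ a ℤ.* N
  e∣aN = subst (+ e ℤˢ.∣_) (sym aN≡U+bM) (ℤˢ.∣m∣n⇒∣m+n
    (ℤˢ.∣ᵤ⇒∣ {+ e} {U} (ℕ.gcd[m,n]∣m ℤ.∣ U ∣ b))
    (ℤˢ.∣m⇒∣m*n M (ℤˢ.∣ᵤ⇒∣ {+ e} {+ b} (ℕ.gcd[m,n]∣n ℤ.∣ U ∣ b))))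
  e⊥a : Coprime e ℤ.∣ a ∣
  e⊥a (i∣e , i∣a) = a⊥b (i∣a , ℕ.∣-trans i∣e (ℕ.gcd[m,n]∣n ℤ.∣ U ∣ b))
  e∣N : e ∣ ℤ.∣ N ∣
  e∣N = ℤ.coprime-divisor (+ e) a N e⊥a (ℤˢ.∣⇒∣ᵤ e∣aN)

+/1≡+*+/⇔*≡* : ∀ b t q u .{{_ : NonZero t}} → (+ b / 1 ≡ (+ q ℤ.* + u) / t) ⇔ (b ℕ.* t ≡ q ℕ.* u)
+/1≡+*+/⇔*≡* b t q u = mk⇔
  (λ eq → ℤ.+-injective (begin
    + (b ℕ.* t)            ≡⟨ ℤ.pos-* b t ⟩
    + b ℤ.* + t            ≡⟨ /≡/⇒*≡* (+ b) (+ q ℤ.* + u) 1 t eq ⟩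
    + q ℤ.* + u ℤ.* + 1    ≡⟨ ℤ.*-identityʳ (+ q ℤ.* + u) ⟩
    + q ℤ.* + u            ≡⟨ ℤ.pos-* q u ⟨
    + (q ℕ.* u)            ∎))
  (λ eq → *≡*⇒/≡/ (+ b) (+ q ℤ.* + u) 1 t (begin
    + b ℤ.* + t            ≡⟨ ℤ.pos-* b t ⟨
    + (b ℕ.* t)            ≡⟨ cong +_ eq ⟩
    + (q ℕ.* u)            ≡⟨ ℤ.pos-* q u ⟩
    + q ℤ.* + u            ≡⟨ ℤ.*-identityʳ (+ q ℤ.* + u) ⟨
    + q ℤ.* + u ℤ.* + 1    ∎))
  where open ≡-Reasoning

↧ₙ-/≡⇔ : ∀ U b q .{{_ : NonZero b}} .{{_ : NonZero q}} .{{_ : ℤ.Positive U}} →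
  (↧ₙ (U / b) ≡ q) ⇔ (Σ ℕ λ t → Σ (NonZero t) λ t≢0 → Coprime t q × (+ b / 1 ≡ _/_ (+ q ℤ.* U) t {{t≢0}}))
↧ₙ-/≡⇔ U@(+ u@(suc _)) b q = mk⇔ to from
  where
  p : ℚ
  p = U / b
  v d g : ℕ
  v = ℤ.∣ ↥ p ∣
  d = ↧ₙ p
  g = ℕ.gcd u b
  v*g≡u : v ℕ.* g ≡ u
  v*g≡u = trans (sym (ℤ.abs-* (↥ p) (+ g))) (cong ℤ.∣_∣ (ℚ.↥-/ U b))
  d*g≡b : d ℕ.* g ≡ b
  d*g≡b = ↧ₙ-/ U b
  instance
    v≢0 : NonZero v
    v≢0 = ℕ.m*n≢0⇒m≢0 v {{subst NonZero (sym v*g≡u) _}}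
    g≢0 : NonZero g
    g≢0 = ℕ.m*n≢0⇒n≢0 v {{subst NonZero (sym v*g≡u) _}}
  to : d ≡ q → Σ ℕ λ t → Σ (NonZero t) λ t≢0 → Coprime t q × (+ b / 1 ≡ _/_ (+ q ℤ.* U) t {{t≢0}})
  to refl = v , v≢0 , coprime-↥-↧ₙ p , Equivalence.from (+/1≡+*+/⇔*≡* b v d u) b*v≡d*u
    where
    b*v≡d*u : b ℕ.* v ≡ d ℕ.* u
    b*v≡d*u = begin
      b ℕ.* v           ≡⟨ cong (ℕ._* v) d*g≡b ⟨
      d ℕ.* g ℕ.* v     ≡⟨ ℕ.*-assoc d g v ⟩
      d ℕ.* (g ℕ.* v)   ≡⟨ cong (d ℕ.*_) (ℕ.*-comm g v) ⟩
      d ℕ.* (v ℕ.* g)   ≡⟨ cong (d ℕ.*_) v*g≡u ⟩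
      d ℕ.* u           ∎
      where open ≡-Reasoning
  from : (Σ ℕ λ t → Σ (NonZero t) λ t≢0 → Coprime t q × (+ b / 1 ≡ _/_ (+ q ℤ.* U) t {{t≢0}})) → d ≡ q
  from (t , t≢0 , t⊥q , eq) = scaled-coprime-denominator-unique (coprime-↥-↧ₙ p) t⊥q
    (subst₂ (λ x y → x ℕ.* t ≡ q ℕ.* y) (sym d*g≡b) (sym v*g≡u) (Equivalence.to (+/1≡+*+/⇔*≡* b t q u {{t≢0}}) eq))

a*a+1-positive : ∀ a → ℤ.Positive (a ℤ.* a ℤ.+ + 1)
a*a+1-positive a = subst ℤ.Positive (sym (a*a+1≡+[1+∣a∣²] a)) _
  where
  a*a+1≡+[1+∣a∣²] : ∀ a → a ℤ.* a ℤ.+ + 1 ≡ + suc (ℤ.∣ a ∣ ℕ.* ℤ.∣ a ∣)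
  a*a+1≡+[1+∣a∣²] (+ n)    = trans (ℤ.+-comm (+ n ℤ.* + n) (+ 1)) (cong (λ x → + 1 ℤ.+ x) (sym (ℤ.pos-* n n)))
  a*a+1≡+[1+∣a∣²] -[1+ n ] = ℤ.+-comm (-[1+ n ] ℤ.* -[1+ n ]) (+ 1)

-- The sawtooth function at m / b

floor≡↥/↧ : ∀ p → floor p ≡ ↥ p ℤ./ ↧ p
floor≡↥/↧ (mkℚ _ _ _) = refl

-- Defined through floor, as saw is, rather than through ℤ._%_.
rem : ℤ → (b : ℕ) → .{{NonZero b}} → ℕ
rem m b = ℤ.∣ m ℤ.- floor (m / b) ℤ.* + b ∣

module _ (m : ℤ) (b : ℕ) .{{_ : NonZero b}} where

  private instance
    b*1≢0 : NonZero (b ℕ.* 1)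
    b*1≢0 = ℕ.m*n≢0 b 1
    b*1*2≢0 : NonZero (b ℕ.* 1 ℕ.* 2)
    b*1*2≢0 = ℕ.m*n≢0 (b ℕ.* 1) 2
    2*b≢0 : NonZero (2 ℕ.* b)
    2*b≢0 = ℕ.m*n≢0 2 b

  private
    p : ℚ
    p = m / b
    F d : ℤ
    F = floor p
    d = ↧ p
    R : ℕ
    R = ↥ p ℤ.% d

    m*d≡↥p*b : m ℤ.* d ≡ ↥ p ℤ.* + b
    m*d≡↥p*b = begin
      m ℤ.* d               ≡⟨ cong (ℤ._* d) (ℚ.↥-/ m b) ⟨
      ↥ p ℤ.* g ℤ.* d       ≡⟨ ℤ.*-assoc (↥ p) g d ⟩
      ↥ p ℤ.* (g ℤ.* d)     ≡⟨ cong (↥ p ℤ.*_) (ℤ.*-comm g d) ⟩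
      ↥ p ℤ.* (d ℤ.* g)     ≡⟨ cong (↥ p ℤ.*_) (ℚ.↧-/ m b) ⟩
      ↥ p ℤ.* + b           ∎
      where
      open ≡-Reasoning
      g : ℤ
      g = ℤ.gcd m (+ b)

    -- m / b reduces to ↥ p / d, and ⌊m / b⌋ is computed as ↥ p div d; so the remainder of ↥ p
    -- modulo d, scaled by b / d, is the remainder of m modulo b.
    [m-Fb]*d≡R*b : (m ℤ.- F ℤ.* + b) ℤ.* d ≡ + R ℤ.* + b
    [m-Fb]*d≡R*b = begin
      (m ℤ.- F ℤ.* + b) ℤ.* d        ≡⟨ distrib m F (+ b) d ⟩
      m ℤ.* d ℤ.- F ℤ.* d ℤ.* + b    ≡⟨ cong (ℤ._- F ℤ.* d ℤ.* + b) m*d≡↥p*b ⟩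
      ↥ p ℤ.* + b ℤ.- F ℤ.* d ℤ.* + b ≡⟨ factor (↥ p) F d (+ b) ⟩
      (↥ p ℤ.- F ℤ.* d) ℤ.* + b      ≡⟨ cong (ℤ._* + b) ↥p-Fd≡R ⟩
      + R ℤ.* + b                    ∎
      where
      open ≡-Reasoning
      distrib : ∀ m F b d → (m ℤ.- F ℤ.* b) ℤ.* d ≡ m ℤ.* d ℤ.- F ℤ.* d ℤ.* b
      distrib = solve-∀
      factor : ∀ x F d b → x ℤ.* b ℤ.- F ℤ.* d ℤ.* b ≡ (x ℤ.- F ℤ.* d) ℤ.* b
      factor = solve-∀
      cancel : ∀ r x → r ℤ.+ x ℤ.- x ≡ r
      cancel = solve-∀
      ↥p-Fd≡R : ↥ p ℤ.- F ℤ.* d ≡ + R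
      ↥p-Fd≡R = begin
        ↥ p ℤ.- F ℤ.* d                         ≡⟨ cong (ℤ._- F ℤ.* d) (ℤ.a≡a%n+[a/n]*n (↥ p) d) ⟩
        + R ℤ.+ (↥ p ℤ./ d) ℤ.* d ℤ.- F ℤ.* d   ≡⟨ cong (λ x → + R ℤ.+ x ℤ.* d ℤ.- F ℤ.* d) (floor≡↥/↧ p) ⟨
        + R ℤ.+ F ℤ.* d ℤ.- F ℤ.* d             ≡⟨ cancel (+ R) (F ℤ.* d) ⟩
        + R                                     ∎

  +rem : + rem m b ≡ m ℤ.- floor (m / b) ℤ.* + b
  +rem = nonNegative (m ℤ.- F ℤ.* + b) (trans [m-Fb]*d≡R*b (sym (ℤ.pos-* R b)))
    where
    nonNegative : ∀ {d} x → x ℤ.* + suc d ≡ + (R ℕ.* b) → + ℤ.∣ x ∣ ≡ x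
    nonNegative (+ _) _ = refl

  rem<b : rem m b ℕ.< b
  rem<b = ℕ.*-cancelʳ-< (↧ₙ p) (rem m b) b (begin-strict
    rem m b ℕ.* ↧ₙ p  ≡⟨ ℤ.+-injective (trans (ℤ.pos-* (rem m b) (↧ₙ p)) (trans (cong (ℤ._* d) +rem) (trans [m-Fb]*d≡R*b (sym (ℤ.pos-* R b))))) ⟩
    R ℕ.* b           <⟨ ℕ.*-monoˡ-< b (ℤ.n%d<d (↥ p) d) ⟩
    ↧ₙ p ℕ.* b        ≡⟨ ℕ.*-comm (↧ₙ p) b ⟩
    b ℕ.* ↧ₙ p        ∎)
    where open ℕ.≤-Reasoning

  b∣m-rem : b ∣ ℤ.∣ m ℤ.- + rem m b ∣
  b∣m-rem = subst (b ∣_) (sym (trans (cong ℤ.∣_∣ m-rem≡Fb) (ℤ.abs-* F (+ b)))) (ℕ.n∣m*n ℤ.∣ F ∣)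
    where
    cancel : ∀ m x → m ℤ.- (m ℤ.- x) ≡ x
    cancel = solve-∀
    m-rem≡Fb : m ℤ.- + rem m b ≡ F ℤ.* + b
    m-rem≡Fb = trans (cong (λ r → m ℤ.- r) +rem) (cancel m (F ℤ.* + b))

  b∤m⇒rem≢0 : ¬ (b ∣ ℤ.∣ m ∣) → rem m b ≢ 0
  b∤m⇒rem≢0 b∤m rem≡0 =
    b∤m (subst (λ x → b ∣ ℤ.∣ x ∣) (ℤ.+-identityʳ m) (subst (λ r → b ∣ ℤ.∣ m ℤ.- + r ∣) rem≡0 b∣m-rem))

  saw-/-∣ : b ∣ ℤ.∣ m ∣ → saw (m / b) ≡ 0ℚ
  saw-/-∣ b∣m with ↧ₙ (m / b) ℕ.≟ 1
  ... | yes _     = refl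
  ... | no ↧ₙ≢1 = ⊥-elim (↧ₙ≢1 (∣⇒↧ₙ-/≡1 m b b∣m))

  saw-/-∤ : ¬ (b ∣ ℤ.∣ m ∣) → saw (m / b) ≡ (+ 2 ℤ.* + rem m b ℤ.- + b) / (2 ℕ.* b)
  saw-/-∤ b∤m with ↧ₙ (m / b) ℕ.≟ 1
  ... | yes ↧ₙ≡1 = ⊥-elim (b∤m (↧ₙ-/≡1⇒∣ m b ↧ₙ≡1))
  ... | no _      = begin
    m / b ℚ.- F / 1 ℚ.- ½
      ≡⟨ cong₂ (λ x y → m / b ℚ.+ x ℚ.+ y) (-‿/ F 1) (-‿/ (+ 1) 2) ⟩
    m / b ℚ.+ (ℤ.- F) / 1 ℚ.+ (ℤ.- + 1) / 2
      ≡⟨ cong (ℚ._+ (ℤ.- + 1) / 2) (/-+-/ m (ℤ.- F) b 1) ⟩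
    (m ℤ.* + 1 ℤ.+ (ℤ.- F) ℤ.* + b) / (b ℕ.* 1) ℚ.+ (ℤ.- + 1) / 2
      ≡⟨ /-+-/ (m ℤ.* + 1 ℤ.+ (ℤ.- F) ℤ.* + b) (ℤ.- + 1) (b ℕ.* 1) 2 ⟩
    ((m ℤ.* + 1 ℤ.+ (ℤ.- F) ℤ.* + b) ℤ.* + 2 ℤ.+ (ℤ.- + 1) ℤ.* + (b ℕ.* 1)) / (b ℕ.* 1 ℕ.* 2)
      ≡⟨ ℚ./-cong numerator denominator ⟩
    (+ 2 ℤ.* + rem m b ℤ.- + b) / (2 ℕ.* b) ∎
    where
    open ≡-Reasoning
    expand : ∀ m F b → (m ℤ.* + 1 ℤ.+ (ℤ.- F) ℤ.* b) ℤ.* + 2 ℤ.+ (ℤ.- + 1) ℤ.* b ≡ + 2 ℤ.* (m ℤ.- F ℤ.* b) ℤ.- b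
    expand = solve-∀
    numerator : (m ℤ.* + 1 ℤ.+ (ℤ.- F) ℤ.* + b) ℤ.* + 2 ℤ.+ (ℤ.- + 1) ℤ.* + (b ℕ.* 1) ≡ + 2 ℤ.* + rem m b ℤ.- + b
    numerator = begin
      (m ℤ.* + 1 ℤ.+ (ℤ.- F) ℤ.* + b) ℤ.* + 2 ℤ.+ (ℤ.- + 1) ℤ.* + (b ℕ.* 1)
        ≡⟨ cong (λ x → (m ℤ.* + 1 ℤ.+ (ℤ.- F) ℤ.* + b) ℤ.* + 2 ℤ.+ (ℤ.- + 1) ℤ.* + x) (ℕ.*-identityʳ b) ⟩
      (m ℤ.* + 1 ℤ.+ (ℤ.- F) ℤ.* + b) ℤ.* + 2 ℤ.+ (ℤ.- + 1) ℤ.* + b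
        ≡⟨ expand m F (+ b) ⟩
      + 2 ℤ.* (m ℤ.- F ℤ.* + b) ℤ.- + b
        ≡⟨ cong (λ r → + 2 ℤ.* r ℤ.- + b) +rem ⟨
      + 2 ℤ.* + rem m b ℤ.- + b ∎
    denominator : b ℕ.* 1 ℕ.* 2 ≡ 2 ℕ.* b
    denominator = trans (cong (ℕ._* 2) (ℕ.*-identityʳ b)) (ℕ.*-comm b 2)

divides-difference⇒≡ : ∀ {n x y} → x < n → y < n → n ∣ ℤ.∣ + x ℤ.- + y ∣ → x ≡ y
divides-difference⇒≡ {n} {x} {y} x<n y<n n∣x-y =
  ℤ.+-injective (ℤ.i-j≡0⇒i≡j (+ x) (+ y) (ℤ.∣i∣≡0⇒i≡0 (small n∣x-y ∣x-y∣<n)))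
  where
  ∣x-y∣<n : ℤ.∣ + x ℤ.- + y ∣ < n
  ∣x-y∣<n = ℕ.≤-<-trans
    (subst (_≤ x ℕ.⊔ y) (cong ℤ.∣_∣ (sym (ℤ.[+m]-[+n]≡m⊖n x y))) (ℤ.∣m⊝n∣≤m⊔n x y))
    (ℕ.⊔-lub x<n y<n)
  small : ∀ {d} → n ∣ d → d < n → d ≡ 0
  small {zero}  _   _   = refl
  small {suc _} n∣d d<n = ⊥-elim (ℕ.<⇒≱ d<n (ℕ.∣⇒≤ n∣d))

rem[+j]≡j : ∀ {j b} .{{_ : NonZero b}} → j < b → rem (+ j) b ≡ j
rem[+j]≡j {j} {b} j<b = sym (divides-difference⇒≡ j<b (rem<b (+ j) b) (b∣m-rem (+ j) b))

-- Integer sums over 1 ≤ j ≤ n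

sumFrom1ℤ : ℕ → (ℕ → ℤ) → ℤ
sumFrom1ℤ zero    f = + 0
sumFrom1ℤ (suc n) f = sumFrom1ℤ n f ℤ.+ f (suc n)

sumFrom1ℤ-cong : ∀ n {f g} → (∀ j → 1 ≤ j → j ≤ n → f j ≡ g j) → sumFrom1ℤ n f ≡ sumFrom1ℤ n g
sumFrom1ℤ-cong zero    f≗g = refl
sumFrom1ℤ-cong (suc n) f≗g = cong₂ ℤ._+_
  (sumFrom1ℤ-cong n (λ j 1≤j j≤n → f≗g j 1≤j (ℕ.m≤n⇒m≤1+n j≤n)))
  (f≗g (suc n) (s≤s z≤n) ℕ.≤-refl)

sumFrom1ℤ-+ : ∀ n f g → sumFrom1ℤ n (λ j → f j ℤ.+ g j) ≡ sumFrom1ℤ n f ℤ.+ sumFrom1ℤ n g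
sumFrom1ℤ-+ zero    f g = refl
sumFrom1ℤ-+ (suc n) f g = trans (cong (ℤ._+ (f (suc n) ℤ.+ g (suc n))) (sumFrom1ℤ-+ n f g))
  (interchange (sumFrom1ℤ n f) (sumFrom1ℤ n g) (f (suc n)) (g (suc n)))
  where
  interchange : ∀ a b c d → a ℤ.+ b ℤ.+ (c ℤ.+ d) ≡ a ℤ.+ c ℤ.+ (b ℤ.+ d)
  interchange = solve-∀

sumFrom1ℤ-*ˡ : ∀ n c f → sumFrom1ℤ n (λ j → c ℤ.* f j) ≡ c ℤ.* sumFrom1ℤ n f
sumFrom1ℤ-*ˡ zero    c f = sym (ℤ.*-zeroʳ c)
sumFrom1ℤ-*ˡ (suc n) c f = trans (cong (ℤ._+ c ℤ.* f (suc n)) (sumFrom1ℤ-*ˡ n c f))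
  (sym (ℤ.*-distribˡ-+ c (sumFrom1ℤ n f) (f (suc n))))

-- The coefficients carry the factors 6 and 2 so that the closed form needs no division.
sumFrom1ℤ-quadratic : ∀ n c₂ c₁ c₀ →
  sumFrom1ℤ n (λ j → + 6 ℤ.* c₂ ℤ.* (+ j ℤ.* + j) ℤ.+ + 2 ℤ.* c₁ ℤ.* + j ℤ.+ c₀)
    ≡ c₂ ℤ.* (+ n ℤ.* (+ n ℤ.+ + 1) ℤ.* (+ 2 ℤ.* + n ℤ.+ + 1)) ℤ.+ c₁ ℤ.* (+ n ℤ.* (+ n ℤ.+ + 1)) ℤ.+ + n ℤ.* c₀
sumFrom1ℤ-quadratic zero    c₂ c₁ c₀ = base c₂ c₁ c₀
  where
  base : ∀ c₂ c₁ c₀ → + 0 ≡ c₂ ℤ.* (+ 0 ℤ.* (+ 0 ℤ.+ + 1) ℤ.* (+ 2 ℤ.* + 0 ℤ.+ + 1)) ℤ.+ c₁ ℤ.* (+ 0 ℤ.* (+ 0 ℤ.+ + 1)) ℤ.+ + 0 ℤ.* c₀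
  base = solve-∀
sumFrom1ℤ-quadratic (suc n) c₂ c₁ c₀ =
  trans (cong (ℤ._+ (+ 6 ℤ.* c₂ ℤ.* (+ suc n ℤ.* + suc n) ℤ.+ + 2 ℤ.* c₁ ℤ.* + suc n ℤ.+ c₀)) (sumFrom1ℤ-quadratic n c₂ c₁ c₀))
        (step c₂ c₁ c₀ (+ n))
  where
  step : ∀ c₂ c₁ c₀ x →
    c₂ ℤ.* (x ℤ.* (x ℤ.+ + 1) ℤ.* (+ 2 ℤ.* x ℤ.+ + 1)) ℤ.+ c₁ ℤ.* (x ℤ.* (x ℤ.+ + 1)) ℤ.+ x ℤ.* c₀
      ℤ.+ (+ 6 ℤ.* c₂ ℤ.* ((+ 1 ℤ.+ x) ℤ.* (+ 1 ℤ.+ x)) ℤ.+ + 2 ℤ.* c₁ ℤ.* (+ 1 ℤ.+ x) ℤ.+ c₀)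
    ≡ c₂ ℤ.* ((+ 1 ℤ.+ x) ℤ.* ((+ 1 ℤ.+ x) ℤ.+ + 1) ℤ.* (+ 2 ℤ.* (+ 1 ℤ.+ x) ℤ.+ + 1))
      ℤ.+ c₁ ℤ.* ((+ 1 ℤ.+ x) ℤ.* ((+ 1 ℤ.+ x) ℤ.+ + 1)) ℤ.+ (+ 1 ℤ.+ x) ℤ.* c₀
  step = solve-∀

module ℤ-Sum = CommutativeMonoidSum ℤ.+-0-commutativeMonoid

injective⇒surjective : ∀ {n} (τ : Fin n → Fin n) → Injective _≡_ _≡_ τ → ∀ k → ∃ λ i → τ i ≡ k
injective⇒surjective {suc n} τ τ-inj k with Fin.any? (λ i → τ i Fin.≟ k)
... | yes hit = hit
... | no miss = ⊥-elim (ℕ.1+n≰n (Fin.injective⇒≤ τ'-inj))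
  where
  τ' : Fin (suc n) → Fin n
  τ' i = punchOut {i = k} {j = τ i} (λ k≡τi → miss (i , sym k≡τi))
  τ'-inj : Injective _≡_ _≡_ τ'
  τ'-inj {i} {j} eq = τ-inj (Fin.punchOut-injective (λ k≡τi → miss (i , sym k≡τi)) (λ k≡τj → miss (j , sym k≡τj)) eq)

sum-injective : ∀ {n} (τ : Fin n → Fin n) → Injective _≡_ _≡_ τ → (h : Fin n → ℤ) → ℤ-Sum.sum (h ∘ τ) ≡ ℤ-Sum.sum h
sum-injective {n} τ τ-inj h = sym (ℤ-Sum.sum-permute h π)
  where
  τ⁻¹ : Fin n → Fin n
  τ⁻¹ k = proj₁ (injective⇒surjective τ τ-inj k)
  π : Permutation n n
  π = permutation τ τ⁻¹ (λ k → proj₂ (injective⇒surjective τ τ-inj k)) (λ i → τ-inj (proj₂ (injective⇒surjective τ τ-inj (τ i))))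

sumFrom1ℤ≡sum : ∀ n h → sumFrom1ℤ n h ≡ ℤ-Sum.sum {n} (λ i → h (suc (toℕ i)))
sumFrom1ℤ≡sum zero    h = refl
sumFrom1ℤ≡sum (suc n) h = begin
  sumFrom1ℤ n h ℤ.+ h (suc n)
    ≡⟨ cong₂ ℤ._+_ (trans (sumFrom1ℤ≡sum n h) (ℤ-Sum.sum-cong-≗ {n} (λ i → cong (h ∘ suc) (sym (Fin.toℕ-inject₁ i)))))
                   (cong (h ∘ suc) (sym (Fin.toℕ-fromℕ n))) ⟩
  ℤ-Sum.sum (Vector.init H) ℤ.+ Vector.last H
    ≡⟨ ℤ-Sum.sum-init-last H ⟨
  ℤ-Sum.sum H ∎
  where
  open ≡-Reasoning
  H : Fin (suc n) → ℤ
  H i = h (suc (toℕ i))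

sumFrom1ℤ-permute : ∀ n (σ : ℕ → ℕ) →
  (∀ j → 1 ≤ j → j ≤ n → 1 ≤ σ j × σ j ≤ n) →
  (∀ i j → 1 ≤ i → i ≤ n → 1 ≤ j → j ≤ n → σ i ≡ σ j → i ≡ j) →
  ∀ h → sumFrom1ℤ n (h ∘ σ) ≡ sumFrom1ℤ n h
sumFrom1ℤ-permute n σ σ-bounded σ-inj h = begin
  sumFrom1ℤ n (h ∘ σ)               ≡⟨ sumFrom1ℤ≡sum n (h ∘ σ) ⟩
  ℤ-Sum.sum {n} (h ∘ σ ∘ suc ∘ toℕ) ≡⟨ ℤ-Sum.sum-cong-≗ {n} (λ i → cong h (sym (suc-toℕ-τ i))) ⟩
  ℤ-Sum.sum {n} (h ∘ suc ∘ toℕ ∘ τ) ≡⟨ sum-injective τ τ-inj (h ∘ suc ∘ toℕ) ⟩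
  ℤ-Sum.sum {n} (h ∘ suc ∘ toℕ) ≡⟨ sumFrom1ℤ≡sum n h ⟨
  sumFrom1ℤ n h                     ∎
  where
  open ≡-Reasoning
  bounded : ∀ (i : Fin n) → 1 ≤ σ (suc (toℕ i)) × σ (suc (toℕ i)) ≤ n
  bounded i = σ-bounded (suc (toℕ i)) (s≤s z≤n) (Fin.toℕ<n i)
  suc-pred-σ : ∀ (i : Fin n) → suc (ℕ.pred (σ (suc (toℕ i)))) ≡ σ (suc (toℕ i))
  suc-pred-σ i = ℕ.suc-pred (σ (suc (toℕ i))) {{ℕ.>-nonZero (proj₁ (bounded i))}}
  pred-σ<n : ∀ (i : Fin n) → ℕ.pred (σ (suc (toℕ i))) < n
  pred-σ<n i = subst (_≤ n) (sym (suc-pred-σ i)) (proj₂ (bounded i))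
  τ : Fin n → Fin n
  τ i = fromℕ< (pred-σ<n i)
  suc-toℕ-τ : ∀ i → suc (toℕ (τ i)) ≡ σ (suc (toℕ i))
  suc-toℕ-τ i = trans (cong suc (Fin.toℕ-fromℕ< (pred-σ<n i))) (suc-pred-σ i)
  τ-inj : Injective _≡_ _≡_ τ
  τ-inj {i} {j} τi≡τj = Fin.toℕ-injective (ℕ.suc-injective (σ-inj _ _ (s≤s z≤n) (Fin.toℕ<n i) (s≤s z≤n) (Fin.toℕ<n j)
    (trans (sym (suc-toℕ-τ i)) (trans (cong (suc ∘ toℕ) τi≡τj) (suc-toℕ-τ j)))))

sumFrom1≡sumFrom1ℤ/ : ∀ n {f : ℕ → ℚ} {g : ℕ → ℤ} D .{{_ : NonZero D}} →
  (∀ j → 1 ≤ j → j ≤ n → f j ≡ g j / D) → sumFrom1 n f ≡ sumFrom1ℤ n g / D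
sumFrom1≡sumFrom1ℤ/ zero    D f≡g/D = sym (ℚ.0/n≡0 D)
sumFrom1≡sumFrom1ℤ/ (suc n) {f} {g} D f≡g/D = trans
  (cong₂ ℚ._+_ (sumFrom1≡sumFrom1ℤ/ n D (λ j 1≤j j≤n → f≡g/D j 1≤j (ℕ.m≤n⇒m≤1+n j≤n)))
               (f≡g/D (suc n) (s≤s z≤n) ℕ.≤-refl))
  (/+/-same (sumFrom1ℤ n g) (g (suc n)) D)

-- The Dedekind sum as an integer sum

φ : ℤ → ℤ → ℤ → ℤ
φ a b x = + 6 ℤ.* (x ℤ.* x) ℤ.- + 6 ℤ.* b ℤ.* (a ℤ.+ + 1) ℤ.* x

ψ : ℤ → ℤ → ℤ → ℤ
ψ a b x = + 6 ℤ.* (a ℤ.* a ℤ.+ + 1) ℤ.* (x ℤ.* x) ℤ.+ + 2 ℤ.* (ℤ.- (+ 3 ℤ.* b ℤ.* (a ℤ.+ + 1))) ℤ.* x ℤ.+ + 3 ℤ.* a ℤ.* (b ℤ.* b)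

-- With r = aj - Fb, summed over j: the φ terms cancel because j ↦ r permutes the residues,
-- ψ has a closed sum, and the last term is a multiple of b².
dedekind-term-identity : ∀ a b j F →
  + 3 ℤ.* a ℤ.* ((+ 2 ℤ.* j ℤ.- b) ℤ.* (+ 2 ℤ.* (a ℤ.* j ℤ.- F ℤ.* b) ℤ.- b)) ℤ.+ φ a b j
    ≡ ψ a b j ℤ.+ φ a b (a ℤ.* j ℤ.- F ℤ.* b) ℤ.+ b ℤ.* b ℤ.* (ℤ.- (+ 6 ℤ.* (F ℤ.* F ℤ.+ F)))
dedekind-term-identity = expanded
  where
  -- φ and ψ unfolded: the ring solver does not look through definitions.
  expanded : ∀ a b j F →
    + 3 ℤ.* a ℤ.* ((+ 2 ℤ.* j ℤ.- b) ℤ.* (+ 2 ℤ.* (a ℤ.* j ℤ.- F ℤ.* b) ℤ.- b))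
      ℤ.+ (+ 6 ℤ.* (j ℤ.* j) ℤ.- + 6 ℤ.* b ℤ.* (a ℤ.+ + 1) ℤ.* j)
    ≡ (+ 6 ℤ.* (a ℤ.* a ℤ.+ + 1) ℤ.* (j ℤ.* j) ℤ.+ + 2 ℤ.* (ℤ.- (+ 3 ℤ.* b ℤ.* (a ℤ.+ + 1))) ℤ.* j ℤ.+ + 3 ℤ.* a ℤ.* (b ℤ.* b))
      ℤ.+ (+ 6 ℤ.* ((a ℤ.* j ℤ.- F ℤ.* b) ℤ.* (a ℤ.* j ℤ.- F ℤ.* b)) ℤ.- + 6 ℤ.* b ℤ.* (a ℤ.+ + 1) ℤ.* (a ℤ.* j ℤ.- F ℤ.* b))
      ℤ.+ b ℤ.* b ℤ.* (ℤ.- (+ 6 ℤ.* (F ℤ.* F ℤ.+ F)))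
  expanded = solve-∀

module DedekindSum (a : ℤ) (n : ℕ) (a⊥b : Coprime ℤ.∣ a ∣ (suc n)) where

  b : ℕ
  b = suc n

  F : ℕ → ℤ
  F j = floor ((a ℤ.* + j) / b)

  ρ : ℕ → ℕ
  ρ j = rem (a ℤ.* + j) b

  +ρ : ∀ j → + ρ j ≡ a ℤ.* + j ℤ.- F j ℤ.* + b
  +ρ j = +rem (a ℤ.* + j) b

  b∤j : ∀ {j} → 1 ≤ j → j ≤ n → ¬ (b ∣ j)
  b∤j 1≤j j≤n = ℕ.>⇒∤ {{ℕ.>-nonZero 1≤j}} (s≤s j≤n)

  b∤aj : ∀ {j} → 1 ≤ j → j ≤ n → ¬ (b ∣ ℤ.∣ a ℤ.* + j ∣)
  b∤aj 1≤j j≤n b∣aj = b∤j 1≤j j≤n (ℕ.coprime-divisor (ℕ.sym a⊥b) (subst (b ∣_) (ℤ.abs-* a (+ _)) b∣aj))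

  ρ-bounded : ∀ j → 1 ≤ j → j ≤ n → 1 ≤ ρ j × ρ j ≤ n
  ρ-bounded j 1≤j j≤n = ℕ.n≢0⇒n>0 (b∤m⇒rem≢0 (a ℤ.* + j) b (b∤aj 1≤j j≤n)) , ℕ.s≤s⁻¹ (rem<b (a ℤ.* + j) b)

  ρ-injective : ∀ i j → 1 ≤ i → i ≤ n → 1 ≤ j → j ≤ n → ρ i ≡ ρ j → i ≡ j
  ρ-injective i j _ i≤n _ j≤n ρi≡ρj = divides-difference⇒≡ (s≤s i≤n) (s≤s j≤n)
    (ℤ.coprime-divisor (+ b) a (+ i ℤ.- + j) (ℕ.sym a⊥b) (ℤˢ.∣⇒∣ᵤ b∣a[i-j]))
    where
    difference : ∀ a i j r → (a ℤ.* i ℤ.- r) ℤ.- (a ℤ.* j ℤ.- r) ≡ a ℤ.* (i ℤ.- j)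
    difference = solve-∀
    b∣ax-ρx : ∀ x → + b ℤˢ.∣ a ℤ.* + x ℤ.- + ρ x
    b∣ax-ρx x = ℤˢ.∣ᵤ⇒∣ {+ b} {a ℤ.* + x ℤ.- + ρ x} (b∣m-rem (a ℤ.* + x) b)
    b∣a[i-j] : + b ℤˢ.∣ a ℤ.* (+ i ℤ.- + j)
    b∣a[i-j] = subst (+ b ℤˢ.∣_) (trans (cong (λ r → (a ℤ.* + i ℤ.- + ρ i) ℤ.- (a ℤ.* + j ℤ.- + r)) (sym ρi≡ρj)) (difference a (+ i) (+ j) (+ ρ i)))
      (ℤˢ.∣m∣n⇒∣m-n (b∣ax-ρx i) (b∣ax-ρx j))

  t : ℕ → ℤ
  t j = (+ 2 ℤ.* + j ℤ.- + b) ℤ.* (+ 2 ℤ.* + ρ j ℤ.- + b)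

  T : ℤ
  T = sumFrom1ℤ n t

  private instance
    2b≢0 : NonZero (2 ℕ.* b)
    2b≢0 = ℕ.m*n≢0 2 b
    4b²≢0 : NonZero (2 ℕ.* b ℕ.* (2 ℕ.* b))
    4b²≢0 = ℕ.m*n≢0 (2 ℕ.* b) (2 ℕ.* b)

  s≡T/4b² : s a b ≡ T / (2 ℕ.* b ℕ.* (2 ℕ.* b))
  s≡T/4b² = begin
    sumFrom1 n term ℚ.+ term b          ≡⟨ cong₂ ℚ._+_ (sumFrom1≡sumFrom1ℤ/ n _ term≡t/4b²) last-term≡0 ⟩
    T / (2 ℕ.* b ℕ.* (2 ℕ.* b)) ℚ.+ 0ℚ  ≡⟨ ℚ.+-identityʳ _ ⟩
    T / (2 ℕ.* b ℕ.* (2 ℕ.* b))         ∎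
    where
    open ≡-Reasoning
    term : ℕ → ℚ
    term j = saw (+ j / b) ℚ.* saw ((a ℤ.* + j) / b)
    last-term≡0 : term b ≡ 0ℚ
    last-term≡0 = trans (cong (ℚ._* saw ((a ℤ.* + b) / b)) (saw-/-∣ (+ b) b ℕ.∣-refl)) (ℚ.*-zeroˡ (saw ((a ℤ.* + b) / b)))
    term≡t/4b² : ∀ j → 1 ≤ j → j ≤ n → term j ≡ t j / (2 ℕ.* b ℕ.* (2 ℕ.* b))
    term≡t/4b² j 1≤j j≤n = begin
      term j
        ≡⟨ cong₂ ℚ._*_ (saw-/-∤ (+ j) b (b∤j 1≤j j≤n)) (saw-/-∤ (a ℤ.* + j) b (b∤aj 1≤j j≤n)) ⟩
      ((+ 2 ℤ.* + rem (+ j) b ℤ.- + b) / (2 ℕ.* b)) ℚ.* ((+ 2 ℤ.* + ρ j ℤ.- + b) / (2 ℕ.* b))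
        ≡⟨ /-*-/ (+ 2 ℤ.* + rem (+ j) b ℤ.- + b) (+ 2 ℤ.* + ρ j ℤ.- + b) (2 ℕ.* b) (2 ℕ.* b) ⟩
      ((+ 2 ℤ.* + rem (+ j) b ℤ.- + b) ℤ.* (+ 2 ℤ.* + ρ j ℤ.- + b)) / (2 ℕ.* b ℕ.* (2 ℕ.* b))
        ≡⟨ cong (λ r → ((+ 2 ℤ.* + r ℤ.- + b) ℤ.* (+ 2 ℤ.* + ρ j ℤ.- + b)) / (2 ℕ.* b ℕ.* (2 ℕ.* b))) (rem[+j]≡j (s≤s j≤n)) ⟩
      t j / (2 ℕ.* b ℕ.* (2 ℕ.* b)) ∎

  U : ℤ
  U = a ℤ.* a ℤ.+ + 1

  G : ℕ → ℤ
  G j = ℤ.- (+ 6 ℤ.* (F j ℤ.* F j ℤ.+ F j))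

  Φ Ψ ΣG : ℤ
  Φ = sumFrom1ℤ n (λ j → φ a (+ b) (+ j))
  Ψ = sumFrom1ℤ n (λ j → ψ a (+ b) (+ j))
  ΣG = sumFrom1ℤ n G

  M : ℤ
  M = U ℤ.* (+ 2 ℤ.* + b ℤ.- + 3) ℤ.- + 3 ℤ.* + n ℤ.+ ΣG

  term-identity : ∀ j → + 3 ℤ.* a ℤ.* t j ℤ.+ φ a (+ b) (+ j) ≡ ψ a (+ b) (+ j) ℤ.+ φ a (+ b) (+ ρ j) ℤ.+ + b ℤ.* + b ℤ.* G j
  term-identity j = subst
    (λ r → + 3 ℤ.* a ℤ.* ((+ 2 ℤ.* + j ℤ.- + b) ℤ.* (+ 2 ℤ.* r ℤ.- + b)) ℤ.+ φ a (+ b) (+ j)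
             ≡ ψ a (+ b) (+ j) ℤ.+ φ a (+ b) r ℤ.+ + b ℤ.* + b ℤ.* G j)
    (sym (+ρ j)) (dedekind-term-identity a (+ b) (+ j) (F j))

  3aT+Φ≡Ψ+Φ+b²ΣG : + 3 ℤ.* a ℤ.* T ℤ.+ Φ ≡ Ψ ℤ.+ Φ ℤ.+ + b ℤ.* + b ℤ.* ΣG
  3aT+Φ≡Ψ+Φ+b²ΣG = begin
    + 3 ℤ.* a ℤ.* T ℤ.+ Φ
      ≡⟨ cong (ℤ._+ Φ) (sumFrom1ℤ-*ˡ n (+ 3 ℤ.* a) t) ⟨
    sumFrom1ℤ n (λ j → + 3 ℤ.* a ℤ.* t j) ℤ.+ Φ
      ≡⟨ sumFrom1ℤ-+ n _ _ ⟨
    sumFrom1ℤ n (λ j → + 3 ℤ.* a ℤ.* t j ℤ.+ φ a (+ b) (+ j))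
      ≡⟨ sumFrom1ℤ-cong n (λ j _ _ → term-identity j) ⟩
    sumFrom1ℤ n (λ j → ψ a (+ b) (+ j) ℤ.+ φ a (+ b) (+ ρ j) ℤ.+ + b ℤ.* + b ℤ.* G j)
      ≡⟨ sumFrom1ℤ-+ n _ _ ⟩
    sumFrom1ℤ n (λ j → ψ a (+ b) (+ j) ℤ.+ φ a (+ b) (+ ρ j)) ℤ.+ sumFrom1ℤ n (λ j → + b ℤ.* + b ℤ.* G j)
      ≡⟨ cong₂ ℤ._+_ (sumFrom1ℤ-+ n _ _) (sumFrom1ℤ-*ˡ n (+ b ℤ.* + b) G) ⟩
    Ψ ℤ.+ sumFrom1ℤ n (λ j → φ a (+ b) (+ ρ j)) ℤ.+ + b ℤ.* + b ℤ.* ΣG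
      ≡⟨ cong (λ x → Ψ ℤ.+ x ℤ.+ + b ℤ.* + b ℤ.* ΣG) (sumFrom1ℤ-permute n ρ ρ-bounded ρ-injective (λ x → φ a (+ b) (+ x))) ⟩
    Ψ ℤ.+ Φ ℤ.+ + b ℤ.* + b ℤ.* ΣG ∎
    where open ≡-Reasoning

  3aT≡b[U+bM] : + 3 ℤ.* a ℤ.* T ≡ + b ℤ.* (U ℤ.+ + b ℤ.* M)
  3aT≡b[U+bM] = begin
    + 3 ℤ.* a ℤ.* T              ≡⟨ ∙-cancelʳ Φ _ _ (trans 3aT+Φ≡Ψ+Φ+b²ΣG (swap Ψ Φ (+ b ℤ.* + b ℤ.* ΣG))) ⟩
    Ψ ℤ.+ + b ℤ.* + b ℤ.* ΣG     ≡⟨ cong (ℤ._+ + b ℤ.* + b ℤ.* ΣG) (sumFrom1ℤ-quadratic n U (ℤ.- (+ 3 ℤ.* + b ℤ.* (a ℤ.+ + 1))) (+ 3 ℤ.* a ℤ.* (+ b ℤ.* + b))) ⟩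
    _                            ≡⟨ collect a (+ n) ΣG ⟩
    + b ℤ.* (U ℤ.+ + b ℤ.* M)    ∎
    where
    open ≡-Reasoning
    swap : ∀ x y z → x ℤ.+ y ℤ.+ z ≡ x ℤ.+ z ℤ.+ y
    swap = solve-∀
    collect : ∀ a x ΣG →
      (a ℤ.* a ℤ.+ + 1) ℤ.* (x ℤ.* (x ℤ.+ + 1) ℤ.* (+ 2 ℤ.* x ℤ.+ + 1))
        ℤ.+ (ℤ.- (+ 3 ℤ.* (+ 1 ℤ.+ x) ℤ.* (a ℤ.+ + 1))) ℤ.* (x ℤ.* (x ℤ.+ + 1))
        ℤ.+ x ℤ.* (+ 3 ℤ.* a ℤ.* ((+ 1 ℤ.+ x) ℤ.* (+ 1 ℤ.+ x)))
        ℤ.+ (+ 1 ℤ.+ x) ℤ.* (+ 1 ℤ.+ x) ℤ.* ΣG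
      ≡ (+ 1 ℤ.+ x) ℤ.* ((a ℤ.* a ℤ.+ + 1) ℤ.+ (+ 1 ℤ.+ x) ℤ.* ((a ℤ.* a ℤ.+ + 1) ℤ.* (+ 2 ℤ.* (+ 1 ℤ.+ x) ℤ.- + 3) ℤ.- + 3 ℤ.* x ℤ.+ ΣG))
    collect = solve-∀

  a[3T]≡[U+bM]b : a ℤ.* (+ 3 ℤ.* T) ≡ (U ℤ.+ + b ℤ.* M) ℤ.* + b
  a[3T]≡[U+bM]b = trans (reassociate a T) (trans 3aT≡b[U+bM] (ℤ.*-comm (+ b) (U ℤ.+ + b ℤ.* M)))
    where
    reassociate : ∀ a T → a ℤ.* (+ 3 ℤ.* T) ≡ + 3 ℤ.* a ℤ.* T
    reassociate = solve-∀

  b∣3T : + b ℤˢ.∣ + 3 ℤ.* T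
  b∣3T = ℤˢ.∣ᵤ⇒∣ (ℤ.coprime-divisor (+ b) a (+ 3 ℤ.* T) (ℕ.sym a⊥b)
                   (ℤˢ.∣⇒∣ᵤ (ℤˢ.divides (U ℤ.+ + b ℤ.* M) a[3T]≡[U+bM]b)))

  N : ℤ
  N = ℤˢ._∣_.quotient b∣3T

  3T≡Nb : + 3 ℤ.* T ≡ N ℤ.* + b
  3T≡Nb = ℤˢ._∣_.equality b∣3T

  aN≡U+bM : a ℤ.* N ≡ U ℤ.+ + b ℤ.* M
  aN≡U+bM = ℤ.*-cancelʳ-≡ (a ℤ.* N) (U ℤ.+ + b ℤ.* M) (+ b) (begin
    a ℤ.* N ℤ.* + b           ≡⟨ ℤ.*-assoc a N (+ b) ⟩
    a ℤ.* (N ℤ.* + b)         ≡⟨ cong (a ℤ.*_) 3T≡Nb ⟨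
    a ℤ.* (+ 3 ℤ.* T)         ≡⟨ a[3T]≡[U+bM]b ⟩
    (U ℤ.+ + b ℤ.* M) ℤ.* + b ∎)
    where open ≡-Reasoning

  S≡N/b : S a b ≡ N / b
  S≡N/b = begin
    (+ 12 / 1) ℚ.* s a b                             ≡⟨ cong ((+ 12 / 1) ℚ.*_) s≡T/4b² ⟩
    (+ 12 / 1) ℚ.* (T / (2 ℕ.* b ℕ.* (2 ℕ.* b)))     ≡⟨ /-*-/ (+ 12) T 1 (2 ℕ.* b ℕ.* (2 ℕ.* b)) ⟩
    _/_ (+ 12 ℤ.* T) (1 ℕ.* (2 ℕ.* b ℕ.* (2 ℕ.* b))) {{1*4b²≢0}} ≡⟨ *≡*⇒/≡/ (+ 12 ℤ.* T) N _ b {{1*4b²≢0}} cross ⟩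
    N / b                                            ∎
    where
    open ≡-Reasoning
    1*4b²≢0 : NonZero (1 ℕ.* (2 ℕ.* b ℕ.* (2 ℕ.* b)))
    1*4b²≢0 = ℕ.m*n≢0 1 (2 ℕ.* b ℕ.* (2 ℕ.* b))
    scale : ∀ T b → + 12 ℤ.* T ℤ.* b ≡ + 4 ℤ.* (+ 3 ℤ.* T) ℤ.* b
    scale = solve-∀
    expand : ∀ N b → + 4 ℤ.* (N ℤ.* b) ℤ.* b ≡ N ℤ.* (+ 1 ℤ.* ((+ 2 ℤ.* b) ℤ.* (+ 2 ℤ.* b)))
    expand = solve-∀
    +[1*4b²] : + (1 ℕ.* (2 ℕ.* b ℕ.* (2 ℕ.* b))) ≡ + 1 ℤ.* ((+ 2 ℤ.* + b) ℤ.* (+ 2 ℤ.* + b))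
    +[1*4b²] = trans (ℤ.pos-* 1 _) (cong (+ 1 ℤ.*_) (trans (ℤ.pos-* (2 ℕ.* b) (2 ℕ.* b)) (cong₂ ℤ._*_ (ℤ.pos-* 2 b) (ℤ.pos-* 2 b))))
    cross : + 12 ℤ.* T ℤ.* + b ≡ N ℤ.* + (1 ℕ.* (2 ℕ.* b ℕ.* (2 ℕ.* b)))
    cross = begin
      + 12 ℤ.* T ℤ.* + b                                  ≡⟨ scale T (+ b) ⟩
      + 4 ℤ.* (+ 3 ℤ.* T) ℤ.* + b                         ≡⟨ cong (λ x → + 4 ℤ.* x ℤ.* + b) 3T≡Nb ⟩
      + 4 ℤ.* (N ℤ.* + b) ℤ.* + b                         ≡⟨ expand N (+ b) ⟩
      N ℤ.* (+ 1 ℤ.* ((+ 2 ℤ.* + b) ℤ.* (+ 2 ℤ.* + b)))   ≡⟨ cong (N ℤ.*_) +[1*4b²] ⟨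
      N ℤ.* + (1 ℕ.* (2 ℕ.* b ℕ.* (2 ℕ.* b)))            ∎

theorem3 : (b q : ℕ) .{{_ : NonZero b}} .{{_ : NonZero q}} (a : ℤ) →
    Coprime ℤ.∣ a ∣ b →
    (∃[ k ] (Coprime ℤ.∣ k ∣ q × S a b ≡ k / q))
      ⇔ (Σ ℕ λ t → Σ (NonZero t) λ nz → Coprime t q ×
           (+ b / 1 ≡ _/_ ((+ q) ℤ.* (a ℤ.* a ℤ.+ + 1)) t {{nz}}))
theorem3 b@(suc n) q a a⊥b =
  ⇔.trans (reduced-form⇔↧ₙ≡ (S a b) q)
  (⇔.trans (mk⇔ (trans (sym ↧ₙS≡↧ₙ[U/b])) (trans ↧ₙS≡↧ₙ[U/b]))
           (↧ₙ-/≡⇔ U b q))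
  where
  open DedekindSum a n a⊥b using (U; N; M; S≡N/b; aN≡U+bM)
  instance
    U-positive : ℤ.Positive U
    U-positive = a*a+1-positive a
  ↧ₙS≡↧ₙ[U/b] : ↧ₙ (S a b) ≡ ↧ₙ (U / b)
  ↧ₙS≡↧ₙ[U/b] = trans (cong ↧ₙ_ S≡N/b) (↧ₙ-/-cong N U b (gcd-cong-mod {a} {N} {M} {U} a⊥b aN≡U+bM))
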